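{- Let $\mathcal{M}$ be the set of Motzkin meanders that contain neither $UD$ nor $HH$ as a contiguous subword, and let $S(u)=\sum_{w\in\mathcal{M}} z^{|w|}u^{\mathrm{level}(w)}$. Put $$W=\sqrt{(1+2z+3z^2+z^3)(1-2z-z^2+z^3)},\qquad r_1=\frac{1+z^2+z^3-W}{2z(1+z)}.$$ Then $$S(u)=\frac{r_1}{z(1-ur_1)},$$ and for every $j\ge0$ the generating function of the meanders in $\mathcal{M}$ ending at level $j$ is $[u^j]S(u)=\frac{r_1^{j+1}}{z}$.
   Context: A Motzkin meander is a finite word $w$ over $\{U,H,D\}$ (heights $+1,0,-1$) all of whose prefixes have nonnegative height sum; $|w|$ is its length and $\mathrm{level}(w)$ its total height sum; the empty word is included; excursions are meanders of level $0$. "Contains $XY$ as a contiguous subword" means two consecutive letters are $X$ then $Y$. Generating functions are formal power series in $z$; $W$ is the formal power series square root with constant term $1$; $[u^j]$ is coefficient extraction. -}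

module Defs where

open import Data.Nat as ℕ using (ℕ; zero; suc; _∸_)
open import Data.Integer as ℤ using (ℤ; +_; -[1+_])
open import Data.Rational as ℚ using (ℚ; 0ℚ; 1ℚ)
open import Data.List using (List; []; _∷_; length; filter; inits; concatMap; map)
open import Data.List.Relation.Unary.All using (All; all?)
open import Data.List.Relation.Binary.Infix.Heterogeneous using (Infix)
open import Data.List.Relation.Binary.Infix.Heterogeneous.Properties using (infix?)
open import Data.Product using (_×_)
open import Relation.Nullary using (¬_; Dec; yes; no)
open import Relation.Nullary.Decidable using (_×-dec_; ¬?; _⊎-dec_)
open import Relation.Binary.PropositionalEquality using (_≡_; refl)

data Letter : Set where
  U H D : Letter

_≟L_ : (x y : Letter) → Dec (x ≡ y)
U ≟L U = yes refl
U ≟L H = no λ ()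
U ≟L D = no λ ()
H ≟L U = no λ ()
H ≟L H = yes refl
H ≟L D = no λ ()
D ≟L U = no λ ()
D ≟L H = no λ ()
D ≟L D = yes refl

Word : Set
Word = List Letter

height : Letter → ℤ
height U = + 1
height H = + 0
height D = -[1+ 0 ]

level : Word → ℤ
level [] = + 0
level (x ∷ w) = height x ℤ.+ level w

IsMeander : Word → Set
IsMeander w = All (λ p → + 0 ℤ.≤ level p) (inits w)

isMeander? : (w : Word) → Dec (IsMeander w)
isMeander? w = all? (λ p → + 0 ℤ.≤? level p) (inits w)

ContainsAdj : Letter → Letter → Word → Set
ContainsAdj X Y w = Infix _≡_ (X ∷ Y ∷ []) w

containsAdj? : (X Y : Letter) (w : Word) → Dec (ContainsAdj X Y w)
containsAdj? X Y w = infix? _≟L_ (X ∷ Y ∷ []) w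

InM : Word → Set
InM w = IsMeander w × (¬ ContainsAdj U D w × ¬ ContainsAdj H H w)

inM? : (w : Word) → Dec (InM w)
inM? w = isMeander? w ×-dec (¬? (containsAdj? U D w) ×-dec ¬? (containsAdj? H H w))

allWords : ℕ → List Word
allWords zero = [] ∷ []
allWords (suc n) = concatMap (λ w → (U ∷ w) ∷ (H ∷ w) ∷ (D ∷ w) ∷ []) (allWords n)

EndsAt : ℕ → Word → Set
EndsAt j w = level w ≡ + j

MAt : ℕ → Word → Set
MAt j w = InM w × EndsAt j w

mAt? : (j : ℕ) (w : Word) → Dec (MAt j w)
mAt? j w = inM? w ×-dec (level w ℤ.≟ + j)

count : ℕ → ℕ → ℕ
count n j = length (filter (mAt? j) (allWords n))

FPS : Set
FPS = ℕ → ℚ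

_≈_ : FPS → FPS → Set
f ≈ g = ∀ n → f n ≡ g n

sumTo : ℕ → (ℕ → ℚ) → ℚ
sumTo zero f = f 0
sumTo (suc n) f = sumTo n f ℚ.+ f (suc n)

_⊕_ : FPS → FPS → FPS
(f ⊕ g) n = f n ℚ.+ g n

⊖_ : FPS → FPS
(⊖ f) n = ℚ.- (f n)

_⊛_ : FPS → FPS → FPS
(f ⊛ g) n = sumTo n (λ k → f k ℚ.* g (n ∸ k))

one : FPS
one zero = 1ℚ
one (suc n) = 0ℚ

_^^_ : FPS → ℕ → FPS
f ^^ zero = one
f ^^ suc j = f ⊛ (f ^^ j)

-- polynomial from its list of integer coefficients (constant term first)
poly : List ℤ → FPS
poly [] n = 0ℚ
poly (c ∷ cs) zero = c ℚ./ 1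
poly (c ∷ cs) (suc n) = poly cs n

zS : FPS
zS = poly (+ 0 ∷ + 1 ∷ [])

radicand : FPS
radicand = poly (+ 1 ∷ + 2 ∷ + 3 ∷ + 1 ∷ []) ⊛ poly (+ 1 ∷ -[1+ 1 ] ∷ -[1+ 0 ] ∷ + 1 ∷ [])

IsW : FPS → Set
IsW W = (W 0 ≡ 1ℚ) × ((W ⊛ W) ≈ radicand)

-- r1 = (1+z^2+z^3-W)/(2z(1+z)), i.e. the (unique) series with 2z(1+z) r1 = 1+z^2+z^3-W
IsR1 : FPS → FPS → Set
IsR1 W r = (poly (+ 0 ∷ + 2 ∷ + 2 ∷ []) ⊛ r) ≈ (poly (+ 1 ∷ + 0 ∷ + 1 ∷ + 1 ∷ []) ⊕ (⊖ W))

-- Bivariate formal power series in z,u: coefficient of z^n u^j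

BPS : Set
BPS = ℕ → ℕ → ℚ

_≈₂_ : BPS → BPS → Set
F ≈₂ G = ∀ n j → F n j ≡ G n j

_⊕₂_ : BPS → BPS → BPS
(F ⊕₂ G) n j = F n j ℚ.+ G n j

⊖₂_ : BPS → BPS
(⊖₂ F) n j = ℚ.- (F n j)

_⊛₂_ : BPS → BPS → BPS
(F ⊛₂ G) n j = sumTo n (λ a → sumTo j (λ b → F a b ℚ.* G (n ∸ a) (j ∸ b)))

lift : FPS → BPS
lift f n zero = f n
lift f n (suc j) = 0ℚ

uB : BPS
uB n j with n | j
... | zero | suc zero = 1ℚ
... | _ | _ = 0ℚ

S : BPS
S n j = + (count n j) ℚ./ 1

coeffU : ℕ → BPS → FPS
coeffU j F n = F n j

{-# OPTIONS --safe #-}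
-- Read a word letter by letter, remembering only its height and its last letter; appending a
-- letter to the words of length n ending at level j in class U, H or D (by last letter) gives
--   U(n+1, j+1) = T(n, j),   H(n+1, j) + H(n, j) = T(n, j),   D(n+1, j) + U(n, j+1) = T(n, j+1),
-- where T = N + U + H + D and N counts the empty word.  Squaring 2z(1+z) r₁ = 1+z²+z³ − W gives
-- z(1+z)(1 + r₁²) = (1+z²+z³) r₁, and this quadratic equation is what makes U_{j+1} = r₁^{j+1},
-- (1+z) H_j = r₁^{j+1}, D_j = r₁^{j+2} − z r₁^{j+1} solve the recurrences with z T_j = r₁^{j+1}.
-- Induction on n then identifies the counts with these coefficients, and the functional equation
-- z(1 − u r₁) S = r₁ is the coefficientwise statement z S_0 = r₁, z S_{j+1} = r₁ · z S_j.
module Submission where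

open import Defs
open import Level using (0ℓ)
open import Algebra.Bundles using (CommutativeMonoid)
import Algebra.Properties.CommutativeSemigroup as CommutativeSemigroupProperties
open import Algebra.Solver.Ring.AlmostCommutativeRing
import Algebra.Solver.Ring
open import Algebra.Structures {A = FPS} _≈_
open import Data.Bool using (Bool; true; false; _∧_; T)
open import Data.Empty using (⊥-elim)
open import Data.Integer as ℤ using (ℤ; +_; -[1+_])
import Data.Integer.Properties as ℤP
open import Data.List using (List; []; _∷_; _∷ʳ_; length; filter; concatMap; inits)
open import Data.List.Relation.Unary.All as All using (All; []; _∷_)
import Data.List.Relation.Unary.All.Properties as AllP
open import Data.List.Relation.Binary.Infix.Heterogeneous using (here; there)
open import Data.List.Relation.Binary.Prefix.Heterogeneous using (_∷_; [])
open import Data.Maybe using (Maybe; just; nothing)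
open import Data.Maybe.Properties using (≡-dec)
open import Data.Nat as ℕ using (ℕ; zero; suc; _+_; _∸_; z≤n; _≡ᵇ_)
import Data.Nat.Coprimality as Coprime
import Data.Nat.Properties as ℕP
import Data.Nat.Solver
open import Data.Product using (_×_; _,_; proj₁; proj₂; ∃-syntax)
open import Data.Rational as ℚ using (ℚ; 0ℚ; 1ℚ)
import Data.Rational.Properties as ℚP
import Data.Rational.Solver
open import Function using (_∘_; case_of_)
open import Function.Bundles using (_⇔_; mk⇔; Equivalence)
open import Relation.Binary.Bundles using (Setoid)
open import Relation.Binary.PropositionalEquality
import Relation.Binary.Reasoning.Setoid as SetoidReasoning
open import Relation.Binary.Structures using (IsEquivalence)
open import Relation.Nullary using (¬_; does; proof)
open import Relation.Nullary.Decidable using (dec⇒maybe)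
open import Relation.Nullary.Reflects using (det; fromEquivalence)
open import Relation.Unary using (Pred; Decidable)

module ℕSolver = Data.Nat.Solver.+-*-Solver
module ℚSolver = Data.Rational.Solver.+-*-Solver

open CommutativeSemigroupProperties ℕP.+-commutativeSemigroup using ()
  renaming (interchange to ℕ-interchange)
open CommutativeSemigroupProperties (CommutativeMonoid.commutativeSemigroup ℚP.+-0-commutativeMonoid) using ()
  renaming (interchange to ℚ-interchange)
open import Algebra.Properties.Group ℚP.+-0-group using (x≈z//y; //-rightDividesˡ)

infixl 6 _+q_ _-q_
infixl 7 _*q_

_+q_ _-q_ _*q_ : ℚ → ℚ → ℚ
_+q_ = ℚ._+_
_-q_ = ℚ._-_
_*q_ = ℚ._*_

sumTo-cong-≤ : ∀ n {f g : ℕ → ℚ} → (∀ k → k ℕ.≤ n → f k ≡ g k) →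
               sumTo n f ≡ sumTo n g
sumTo-cong-≤ zero eq = eq 0 z≤n
sumTo-cong-≤ (suc n) eq =
  cong₂ _+q_ (sumTo-cong-≤ n λ k k≤n → eq k (ℕP.m≤n⇒m≤1+n k≤n)) (eq (suc n) ℕP.≤-refl)

sumTo-cong : ∀ n {f g : ℕ → ℚ} → (∀ k → f k ≡ g k) → sumTo n f ≡ sumTo n g
sumTo-cong n eq = sumTo-cong-≤ n λ k _ → eq k

sumTo-+ : ∀ n (f g : ℕ → ℚ) → sumTo n (λ k → f k +q g k) ≡ sumTo n f +q sumTo n g
sumTo-+ zero f g = refl
sumTo-+ (suc n) f g = trans (cong (_+q (f (suc n) +q g (suc n))) (sumTo-+ n f g))
  (ℚ-interchange (sumTo n f) (sumTo n g) (f (suc n)) (g (suc n)))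

sumTo-*ˡ : ∀ n c (f : ℕ → ℚ) → sumTo n (λ k → c *q f k) ≡ c *q sumTo n f
sumTo-*ˡ zero c f = refl
sumTo-*ˡ (suc n) c f =
  trans (cong (_+q c *q f (suc n)) (sumTo-*ˡ n c f)) (sym (ℚP.*-distribˡ-+ c (sumTo n f) (f (suc n))))

sumTo-neg : ∀ n (f : ℕ → ℚ) → sumTo n (λ k → ℚ.- f k) ≡ ℚ.- sumTo n f
sumTo-neg zero f = refl
sumTo-neg (suc n) f =
  trans (cong (_+q ℚ.- f (suc n)) (sumTo-neg n f)) (sym (ℚP.neg-distrib-+ (sumTo n f) (f (suc n))))

sumTo-head : ∀ n (f : ℕ → ℚ) → (∀ k → f (suc k) ≡ 0ℚ) → sumTo n f ≡ f 0
sumTo-head zero f tail≡0 = refl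
sumTo-head (suc n) f tail≡0 =
  trans (cong₂ _+q_ (sumTo-head n f tail≡0) (tail≡0 n)) (ℚP.+-identityʳ (f 0))

sumTo-zero : ∀ n (f : ℕ → ℚ) → (∀ k → f k ≡ 0ℚ) → sumTo n f ≡ 0ℚ
sumTo-zero n f f≡0 = trans (sumTo-head n f (λ k → f≡0 (suc k))) (f≡0 0)

sumTo-unfoldˡ : ∀ n (f : ℕ → ℚ) → sumTo (suc n) f ≡ f 0 +q sumTo n (λ k → f (suc k))
sumTo-unfoldˡ zero f = refl
sumTo-unfoldˡ (suc n) f =
  trans (cong (_+q f (suc (suc n))) (sumTo-unfoldˡ n f))
        (ℚP.+-assoc (f 0) (sumTo n (λ k → f (suc k))) (f (suc (suc n))))

sumTo-reverse : ∀ n (f : ℕ → ℚ) → sumTo n f ≡ sumTo n (λ k → f (n ∸ k))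
sumTo-reverse zero f = refl
sumTo-reverse (suc n) f = begin
  sumTo n f +q f (suc n)                  ≡⟨ cong (_+q f (suc n)) (sumTo-reverse n f) ⟩
  sumTo n (λ k → f (n ∸ k)) +q f (suc n)  ≡⟨ ℚP.+-comm _ (f (suc n)) ⟩
  f (suc n) +q sumTo n (λ k → f (n ∸ k))  ≡⟨ sym (sumTo-unfoldˡ n (λ k → f (suc n ∸ k))) ⟩
  sumTo (suc n) (λ k → f (suc n ∸ k))     ∎
  where open ≡-Reasoning

shift : FPS → FPS
shift f n = f (suc n)

_·_ : ℚ → FPS → FPS
(c · f) n = c *q f n

0S : FPS
0S n = 0ℚ

const : ℚ → FPS
const c zero = c
const c (suc n) = 0ℚ

⊛-suc : ∀ f g n → (f ⊛ g) (suc n) ≡ f 0 *q g (suc n) +q (shift f ⊛ g) n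
⊛-suc f g n = sumTo-unfoldˡ n (λ k → f k *q g (suc n ∸ k))

⊛-cong : ∀ {f f′ g g′} → f ≈ f′ → g ≈ g′ → (f ⊛ g) ≈ (f′ ⊛ g′)
⊛-cong f≈f′ g≈g′ n = sumTo-cong n λ k → cong₂ _*q_ (f≈f′ k) (g≈g′ (n ∸ k))

⊛-congˡ : ∀ {f f′} g → f ≈ f′ → (f ⊛ g) ≈ (f′ ⊛ g)
⊛-congˡ {f} {f′} g f≈f′ = ⊛-cong {f} {f′} {g} {g} f≈f′ λ _ → refl

⊛-congʳ : ∀ f {g g′} → g ≈ g′ → (f ⊛ g) ≈ (f ⊛ g′)
⊛-congʳ f {g} {g′} = ⊛-cong {f} {f} {g} {g′} λ _ → refl

⊛-comm : ∀ f g → (f ⊛ g) ≈ (g ⊛ f)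
⊛-comm f g n = trans (sumTo-reverse n _) (sumTo-cong-≤ n λ k k≤n →
  trans (cong (λ m → f (n ∸ k) *q g m) (ℕP.m∸[m∸n]≡n k≤n)) (ℚP.*-comm (f (n ∸ k)) (g k)))

⊛-distribˡ : ∀ f g h → (f ⊛ (g ⊕ h)) ≈ ((f ⊛ g) ⊕ (f ⊛ h))
⊛-distribˡ f g h n =
  trans (sumTo-cong n λ k → ℚP.*-distribˡ-+ (f k) (g (n ∸ k)) (h (n ∸ k))) (sumTo-+ n _ _)

⊛-distribʳ : ∀ f g h → ((g ⊕ h) ⊛ f) ≈ ((g ⊛ f) ⊕ (h ⊛ f))
⊛-distribʳ f g h n =
  trans (sumTo-cong n λ k → ℚP.*-distribʳ-+ (f (n ∸ k)) (g k) (h k)) (sumTo-+ n _ _)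

·-⊛ : ∀ c f g n → ((c · f) ⊛ g) n ≡ c *q (f ⊛ g) n
·-⊛ c f g n = trans (sumTo-cong n λ k → ℚP.*-assoc c (f k) (g (n ∸ k))) (sumTo-*ˡ n c _)

⊛-assoc : ∀ f g h n → ((f ⊛ g) ⊛ h) n ≡ (f ⊛ (g ⊛ h)) n
⊛-assoc f g h zero = ℚP.*-assoc (f 0) (g 0) (h 0)
⊛-assoc f g h (suc n) = begin
  ((f ⊛ g) ⊛ h) (suc n)
    ≡⟨ ⊛-suc (f ⊛ g) h n ⟩
  a *q b *q h (suc n) +q (shift (f ⊛ g) ⊛ h) n
    ≡⟨ cong (a *q b *q h (suc n) +q_) (⊛-congˡ h (⊛-suc f g) n) ⟩
  a *q b *q h (suc n) +q (((a · shift g) ⊕ (shift f ⊛ g)) ⊛ h) n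
    ≡⟨ cong (a *q b *q h (suc n) +q_) (⊛-distribʳ h (a · shift g) (shift f ⊛ g) n) ⟩
  a *q b *q h (suc n) +q (((a · shift g) ⊛ h) n +q ((shift f ⊛ g) ⊛ h) n)
    ≡⟨ cong₂ (λ x y → a *q b *q h (suc n) +q (x +q y))
             (·-⊛ a (shift g) h n) (⊛-assoc (shift f) g h n) ⟩
  a *q b *q h (suc n) +q (a *q (shift g ⊛ h) n +q (shift f ⊛ (g ⊛ h)) n)
    ≡⟨ ℚSolver.solve 5 (λ a b c d e → a :* b :* c :+ (a :* d :+ e) := a :* (b :* c :+ d) :+ e)
         refl a b (h (suc n)) ((shift g ⊛ h) n) ((shift f ⊛ (g ⊛ h)) n) ⟩
  a *q (b *q h (suc n) +q (shift g ⊛ h) n) +q (shift f ⊛ (g ⊛ h)) n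
    ≡⟨ cong (λ x → a *q x +q (shift f ⊛ (g ⊛ h)) n) (sym (⊛-suc g h n)) ⟩
  a *q (g ⊛ h) (suc n) +q (shift f ⊛ (g ⊛ h)) n
    ≡⟨ sym (⊛-suc f (g ⊛ h) n) ⟩
  (f ⊛ (g ⊛ h)) (suc n) ∎
  where
  open ≡-Reasoning
  open ℚSolver using (_:+_; _:*_; _:=_)
  a = f 0
  b = g 0

⊛-zeroˡ : ∀ f → (0S ⊛ f) ≈ 0S
⊛-zeroˡ f n = sumTo-zero n _ λ k → ℚP.*-zeroˡ (f (n ∸ k))

const-⊛ : ∀ c f n → (const c ⊛ f) n ≡ c *q f n
const-⊛ c f zero = refl
const-⊛ c f (suc n) =
  trans (⊛-suc (const c) f n) (trans (cong (c *q f (suc n) +q_) (⊛-zeroˡ f n)) (ℚP.+-identityʳ _))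

⊛-identityˡ : ∀ f → (one ⊛ f) ≈ f
⊛-identityˡ f n = trans (⊛-congˡ f one≈const1 n) (trans (const-⊛ 1ℚ f n) (ℚP.*-identityˡ (f n)))
  where
  one≈const1 : one ≈ const 1ℚ
  one≈const1 zero = refl
  one≈const1 (suc n) = refl

≈-isEquivalence : IsEquivalence _≈_
≈-isEquivalence = record
  { refl = λ n → refl ; sym = λ e n → sym (e n) ; trans = λ e e′ n → trans (e n) (e′ n) }

FPS-setoid : Setoid 0ℓ 0ℓ
FPS-setoid = record { isEquivalence = ≈-isEquivalence }

⊕-isCommutativeMonoid : IsCommutativeMonoid _⊕_ 0S
⊕-isCommutativeMonoid = record
  { isMonoid = record
    { isSemigroup = record
      { isMagma = record
        { isEquivalence = ≈-isEquivalence ; ∙-cong = λ e e′ n → cong₂ _+q_ (e n) (e′ n) }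
      ; assoc = λ f g h n → ℚP.+-assoc (f n) (g n) (h n) }
    ; identity = (λ f n → ℚP.+-identityˡ (f n)) , (λ f n → ℚP.+-identityʳ (f n)) }
  ; comm = λ f g n → ℚP.+-comm (f n) (g n) }

⊕-⊛-isCommutativeSemiring : IsCommutativeSemiring _⊕_ _⊛_ 0S one
⊕-⊛-isCommutativeSemiring = record
  { isSemiring = record
    { isSemiringWithoutAnnihilatingZero = record
      { +-isCommutativeMonoid = ⊕-isCommutativeMonoid
      ; *-cong = ⊛-cong
      ; *-assoc = λ f g h → ⊛-assoc f g h
      ; *-identity = ⊛-identityˡ , (λ f n → trans (⊛-comm f one n) (⊛-identityˡ f n))
      ; distrib = (λ f g h → ⊛-distribˡ f g h) , (λ f g h → ⊛-distribʳ f g h) }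
    ; zero = ⊛-zeroˡ , (λ f n → trans (⊛-comm f 0S n) (⊛-zeroˡ f n)) }
  ; *-comm = ⊛-comm }

FPS-ring : AlmostCommutativeRing 0ℓ 0ℓ
FPS-ring = record
  { _≈_ = _≈_ ; _+_ = _⊕_ ; _*_ = _⊛_ ; -_ = ⊖_ ; 0# = 0S ; 1# = one
  ; isAlmostCommutativeRing = record
    { isCommutativeSemiring = ⊕-⊛-isCommutativeSemiring
    ; -‿cong = λ e n → cong ℚ.-_ (e n)
    ; -‿*-distribˡ = λ f g n →
        trans (sumTo-cong n λ k → sym (ℚP.neg-distribˡ-* (f k) (g (n ∸ k)))) (sumTo-neg n _)
    ; -‿+-comm = λ f g n → sym (ℚP.neg-distrib-+ (f n) (g n)) } }

const-morphism : ℚ.+-*-rawRing -Raw-AlmostCommutative⟶ FPS-ring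
const-morphism = record
  { ⟦_⟧ = const
  ; +-homo = λ { a b zero → refl ; a b (suc n) → refl }
  ; *-homo = λ a b n → sym (trans (const-⊛ a (const b) n) (*-const a b n))
  ; -‿homo = λ { a zero → refl ; a (suc n) → refl }
  ; 0-homo = λ { zero → refl ; (suc n) → refl }
  ; 1-homo = λ { zero → refl ; (suc n) → refl } }
  where
  *-const : ∀ a b n → a *q const b n ≡ const (a *q b) n
  *-const a b zero = refl
  *-const a b (suc n) = ℚP.*-zeroʳ a

module FPS-Solver = Algebra.Solver.Ring ℚ.+-*-rawRing FPS-ring const-morphism
  (λ a b → Data.Maybe.map (λ a≡b n → cong (λ c → const c n) a≡b) (dec⇒maybe (a ℚP.≟ b)))

⊕-congˡ : ∀ {f f′} g → f ≈ f′ → (f ⊕ g) ≈ (f′ ⊕ g)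
⊕-congˡ g f≈f′ n = cong (_+q g n) (f≈f′ n)

⊕-congʳ : ∀ f {g g′} → g ≈ g′ → (f ⊕ g) ≈ (f ⊕ g′)
⊕-congʳ f g≈g′ n = cong (f n +q_) (g≈g′ n)

z⊛-zero : ∀ f → (zS ⊛ f) 0 ≡ 0ℚ
z⊛-zero f = ℚP.*-zeroˡ (f 0)

z⊛-suc : ∀ f n → (zS ⊛ f) (suc n) ≡ f n
z⊛-suc f n = begin
  (zS ⊛ f) (suc n)
    ≡⟨ ⊛-suc zS f n ⟩
  0ℚ *q f (suc n) +q (shift zS ⊛ f) n
    ≡⟨ cong₂ _+q_ (ℚP.*-zeroˡ (f (suc n))) (⊛-congˡ f shift-z≈one n) ⟩
  0ℚ +q (one ⊛ f) n
    ≡⟨ trans (ℚP.+-identityˡ _) (⊛-identityˡ f n) ⟩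
  f n ∎
  where
  open ≡-Reasoning
  shift-z≈one : shift zS ≈ one
  shift-z≈one zero = refl
  shift-z≈one (suc n) = refl

z⊛-cancel : ∀ {f g} → (zS ⊛ f) ≈ (zS ⊛ g) → f ≈ g
z⊛-cancel {f} {g} eq n = trans (sym (z⊛-suc f n)) (trans (eq (suc n)) (z⊛-suc g n))

z⊛-shift : ∀ t → t 0 ≡ 0ℚ → (zS ⊛ shift t) ≈ t
z⊛-shift t t0≡0 zero = trans (z⊛-zero (shift t)) (sym t0≡0)
z⊛-shift t t0≡0 (suc n) = z⊛-suc (shift t) n

horner : List ℤ → FPS
horner [] = const 0ℚ
horner (c ∷ cs) = const (c ℚ./ 1) ⊕ (zS ⊛ horner cs)

poly≈horner : ∀ cs → poly cs ≈ horner cs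
poly≈horner [] zero = refl
poly≈horner [] (suc n) = refl
poly≈horner (c ∷ cs) zero = sym (trans (cong (c ℚ./ 1 +q_) (z⊛-zero (horner cs))) (ℚP.+-identityʳ _))
poly≈horner (c ∷ cs) (suc n) =
  trans (poly≈horner cs n) (sym (trans (cong (0ℚ +q_) (z⊛-suc (horner cs) n)) (ℚP.+-identityˡ _)))

1+z : FPS
1+z = const 1ℚ ⊕ zS

1+z⊛-zero : ∀ f → (1+z ⊛ f) 0 ≡ f 0
1+z⊛-zero f = ℚP.*-identityˡ (f 0)

1+z⊛-suc : ∀ f n → (1+z ⊛ f) (suc n) ≡ f (suc n) +q f n
1+z⊛-suc f n = trans (⊛-distribʳ f (const 1ℚ) zS (suc n))
  (cong₂ _+q_ (trans (const-⊛ 1ℚ f (suc n)) (ℚP.*-identityˡ (f (suc n)))) (z⊛-suc f n))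

÷1+z : FPS → FPS
÷1+z t zero = t 0
÷1+z t (suc n) = t (suc n) -q ÷1+z t n

1+z⊛÷1+z : ∀ t → (1+z ⊛ ÷1+z t) ≈ t
1+z⊛÷1+z t zero = 1+z⊛-zero (÷1+z t)
1+z⊛÷1+z t (suc n) = trans (1+z⊛-suc (÷1+z t) n) (//-rightDividesˡ (÷1+z t n) (t (suc n)))

÷1+z-unique : ∀ f t → (1+z ⊛ f) ≈ t → f ≈ ÷1+z t
÷1+z-unique f t eq zero = trans (sym (1+z⊛-zero f)) (eq 0)
÷1+z-unique f t eq (suc n) =
  trans (x≈z//y (f (suc n)) (f n) (t (suc n)) (trans (sym (1+z⊛-suc f n)) (eq (suc n))))
        (cong (t (suc n) -q_) (÷1+z-unique f t eq n))

1+z⊛-cancel : ∀ {f g} → (1+z ⊛ f) ≈ (1+z ⊛ g) → f ≈ g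
1+z⊛-cancel {f} {g} eq n =
  trans (÷1+z-unique f (1+z ⊛ g) eq n) (sym (÷1+z-unique g (1+z ⊛ g) (λ _ → refl) n))

data State : Set where
  dead : State
  at : ℕ → Maybe Letter → State

step : State → Letter → State
step dead _ = dead
step (at h _) U = at (suc h) (just U)
step (at _ (just H)) H = dead
step (at h _) H = at h (just H)
step (at zero _) D = dead
step (at (suc _) (just U)) D = dead
step (at (suc h) _) D = at h (just D)

run : State → Word → State
run s [] = s
run s (x ∷ w) = run (step s x) w

run-dead : ∀ w → run dead w ≡ dead
run-dead [] = refl
run-dead (x ∷ w) = run-dead w

start : State
start = at 0 nothing

_◃_ : Maybe Letter → Word → Word
nothing ◃ w = w
just x ◃ w = x ∷ w

MeanderFrom : ℤ → Word → Set
MeanderFrom c w = All (λ q → + 0 ℤ.≤ c ℤ.+ level q) (inits w)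

Admissible : ℕ → Maybe Letter → Word → Set
Admissible h p w = MeanderFrom (+ h) w × ¬ ContainsAdj U D (p ◃ w) × ¬ ContainsAdj H H (p ◃ w)

data Blocked : ℕ → Maybe Letter → Letter → Set where
  UD : ∀ {h} → Blocked h (just U) D
  HH : ∀ {h} → Blocked h (just H) H
  below-zero : ∀ {p} → Blocked 0 p D

+height-U : ∀ h → + suc h ≡ + h ℤ.+ height U
+height-U h = cong +_ (ℕP.+-comm 1 h)

+height-H : ∀ h → + h ≡ + h ℤ.+ height H
+height-H h = sym (ℤP.+-identityʳ (+ h))

+height-D : ∀ h → + h ≡ + suc h ℤ.+ height D
+height-D h = sym (trans (ℤP.+-comm (+ suc h) -[1+ 0 ]) (ℤP.[1+m]⊖[1+n]≡m⊖n h 0))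

data StepView (h : ℕ) (p : Maybe Letter) (x : Letter) : Set where
  alive : ∀ h′ → step (at h p) x ≡ at h′ (just x) → + h′ ≡ + h ℤ.+ height x →
          ¬ Blocked h p x → StepView h p x
  blocked : step (at h p) x ≡ dead → Blocked h p x → StepView h p x

step-view : ∀ h p x → StepView h p x
step-view h p U = alive (suc h) refl (+height-U h) λ ()
step-view h (just H) H = blocked refl HH
step-view h nothing H = alive h refl (+height-H h) λ ()
step-view h (just U) H = alive h refl (+height-H h) λ ()
step-view h (just D) H = alive h refl (+height-H h) λ ()
step-view zero p D = blocked refl below-zero
step-view (suc h) (just U) D = blocked refl UD
step-view (suc h) nothing D = alive h refl (+height-D h) λ ()
step-view (suc h) (just H) D = alive h refl (+height-D h) λ ()
step-view (suc h) (just D) D = alive h refl (+height-D h) λ ()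

MeanderFrom-∷⁻ : ∀ c x w → MeanderFrom c (x ∷ w) → MeanderFrom (c ℤ.+ height x) w
MeanderFrom-∷⁻ c x w (_ ∷ rest) =
  All.map (λ {q} → subst (+ 0 ℤ.≤_) (sym (ℤP.+-assoc c (height x) (level q)))) (AllP.map⁻ rest)

MeanderFrom-∷⁺ : ∀ c x w → + 0 ℤ.≤ c → MeanderFrom (c ℤ.+ height x) w →
                 MeanderFrom c (x ∷ w)
MeanderFrom-∷⁺ c x w 0≤c m =
  subst (+ 0 ℤ.≤_) (sym (ℤP.+-identityʳ c)) 0≤c
  ∷ AllP.map⁺ (All.map (λ {q} → subst (+ 0 ℤ.≤_) (ℤP.+-assoc c (height x) (level q))) m)

¬ContainsAdj-short : ∀ {X Y} p → ¬ ContainsAdj X Y (p ◃ [])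
¬ContainsAdj-short nothing (here ())
¬ContainsAdj-short (just y) (here (_ ∷ ()))
¬ContainsAdj-short (just y) (there (here ()))

¬ContainsAdj-◃⁻ : ∀ {X Y} p w → ¬ ContainsAdj X Y (p ◃ w) → ¬ ContainsAdj X Y w
¬ContainsAdj-◃⁻ nothing w ¬c = ¬c
¬ContainsAdj-◃⁻ (just y) w ¬c c = ¬c (there c)

¬ContainsAdj-◃⁺ : ∀ {X Y} p x w → ¬ (p ≡ just X × x ≡ Y) → ¬ ContainsAdj X Y (x ∷ w) →
                  ¬ ContainsAdj X Y (p ◃ (x ∷ w))
¬ContainsAdj-◃⁺ nothing x w _ ¬c = ¬c
¬ContainsAdj-◃⁺ (just y) x w ¬pair ¬c (here (refl ∷ refl ∷ [])) = ¬pair (refl , refl)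
¬ContainsAdj-◃⁺ (just y) x w ¬pair ¬c (there c) = ¬c c

Blocked⇒¬Admissible : ∀ {h p x} w → Blocked h p x → ¬ Admissible h p (x ∷ w)
Blocked⇒¬Admissible w UD (_ , ¬UD , _) = ¬UD (here (refl ∷ refl ∷ []))
Blocked⇒¬Admissible w HH (_ , _ , ¬HH) = ¬HH (here (refl ∷ refl ∷ []))
Blocked⇒¬Admissible w below-zero ((_ ∷ () ∷ _) , _)

¬Blocked-pair : ∀ {h p x X Y} → ¬ Blocked h p x → Blocked h (just X) Y → ¬ (p ≡ just X × x ≡ Y)
¬Blocked-pair ¬b b (refl , refl) = ¬b b

Admissible-∷⁻ : ∀ {h p x h′} w → + h′ ≡ + h ℤ.+ height x →
                Admissible h p (x ∷ w) → Admissible h′ (just x) w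
Admissible-∷⁻ {h} {p} {x} w h′≡ (m , ¬UD , ¬HH) =
  subst (λ c → MeanderFrom c w) (sym h′≡) (MeanderFrom-∷⁻ (+ h) x w m) ,
  ¬ContainsAdj-◃⁻ p (x ∷ w) ¬UD , ¬ContainsAdj-◃⁻ p (x ∷ w) ¬HH

Admissible-∷⁺ : ∀ {h p x h′} w → + h′ ≡ + h ℤ.+ height x → ¬ Blocked h p x →
                Admissible h′ (just x) w → Admissible h p (x ∷ w)
Admissible-∷⁺ {h} {p} {x} w h′≡ ¬blocked (m , ¬UD , ¬HH) =
  MeanderFrom-∷⁺ (+ h) x w (ℤ.+≤+ z≤n) (subst (λ c → MeanderFrom c w) h′≡ m) ,
  ¬ContainsAdj-◃⁺ p x w (¬Blocked-pair ¬blocked UD) ¬UD ,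
  ¬ContainsAdj-◃⁺ p x w (¬Blocked-pair ¬blocked HH) ¬HH

run-sound : ∀ h p w {m q} → run (at h p) w ≡ at m q → Admissible h p w × + h ℤ.+ level w ≡ + m
run-sound h p [] refl =
  ((ℤ.+≤+ z≤n ∷ []) , ¬ContainsAdj-short p , ¬ContainsAdj-short p) , ℤP.+-identityʳ (+ h)
run-sound h p (x ∷ w) eq with step-view h p x
... | blocked step≡dead _ rewrite step≡dead | run-dead w = case eq of λ ()
... | alive h′ step≡ h′≡ ¬blocked rewrite step≡ with run-sound h′ (just x) w eq
... | admissible , level≡ = Admissible-∷⁺ w h′≡ ¬blocked admissible ,
  trans (sym (ℤP.+-assoc (+ h) (height x) (level w))) (trans (cong (ℤ._+ level w) (sym h′≡)) level≡)

run-complete : ∀ h p w → Admissible h p w → ∃[ m ] ∃[ q ] run (at h p) w ≡ at m q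
run-complete h p [] _ = h , p , refl
run-complete h p (x ∷ w) admissible with step-view h p x
... | blocked _ b = ⊥-elim (Blocked⇒¬Admissible w b admissible)
... | alive h′ step≡ h′≡ _ rewrite step≡ =
  run-complete h′ (just x) w (Admissible-∷⁻ w h′≡ admissible)

accepts : ℕ → State → Bool
accepts j dead = false
accepts j (at h _) = h ≡ᵇ j

MeanderFrom0⇔IsMeander : ∀ w → MeanderFrom (+ 0) w ⇔ IsMeander w
MeanderFrom0⇔IsMeander w = mk⇔
  (All.map (λ {q} → subst (+ 0 ℤ.≤_) (ℤP.+-identityˡ (level q))))
  (All.map (λ {q} → subst (+ 0 ℤ.≤_) (sym (ℤP.+-identityˡ (level q)))))

run-sound-start : ∀ w {m q} → run start w ≡ at m q → InM w × level w ≡ + m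
run-sound-start w run≡ with run-sound 0 nothing w run≡
... | (meander , ¬UD , ¬HH) , level≡ =
  (Equivalence.to (MeanderFrom0⇔IsMeander w) meander , ¬UD , ¬HH) ,
  trans (sym (ℤP.+-identityˡ (level w))) level≡

accepts⇒MAt : ∀ j w → T (accepts j (run start w)) → MAt j w
accepts⇒MAt j w accepted with run start w in run≡
... | at m q = proj₁ (run-sound-start w run≡) ,
  trans (proj₂ (run-sound-start w run≡)) (cong +_ (ℕP.≡ᵇ⇒≡ m j accepted))

MAt⇒accepts : ∀ j w → MAt j w → T (accepts j (run start w))
MAt⇒accepts j w ((meander , ¬UD , ¬HH) , level≡j)
  with run-complete 0 nothing w (Equivalence.from (MeanderFrom0⇔IsMeander w) meander , ¬UD , ¬HH)
... | m , q , run≡ rewrite run≡ =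
  ℕP.≡⇒≡ᵇ m j (ℤP.+-injective (trans (sym (proj₂ (run-sound-start w run≡))) level≡j))

mAt?≡accepts : ∀ j w → does (mAt? j w) ≡ accepts j (run start w)
mAt?≡accepts j w = det (proof (mAt? j w)) (fromEquivalence (accepts⇒MAt j w) (MAt⇒accepts j w))

indicator : Bool → ℕ
indicator true = 1
indicator false = 0

sumL : (Word → ℕ) → List Word → ℕ
sumL φ [] = 0
sumL φ (w ∷ ws) = φ w ℕ.+ sumL φ ws

length-filter : ∀ {P : Pred Word 0ℓ} (P? : Decidable P) ws →
                length (filter P? ws) ≡ sumL (λ w → indicator (does (P? w))) ws
length-filter P? [] = refl
length-filter P? (w ∷ ws) with does (P? w)
... | true = cong suc (length-filter P? ws)
... | false = length-filter P? ws

sumL-cong : ∀ {φ ψ} ws → (∀ w → φ w ≡ ψ w) → sumL φ ws ≡ sumL ψ ws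
sumL-cong [] eq = refl
sumL-cong (w ∷ ws) eq = cong₂ _+_ (eq w) (sumL-cong ws eq)

sumL-+ : ∀ φ ψ ws → sumL (λ w → φ w + ψ w) ws ≡ sumL φ ws + sumL ψ ws
sumL-+ φ ψ [] = refl
sumL-+ φ ψ (w ∷ ws) =
  trans (cong (_+_ (φ w + ψ w)) (sumL-+ φ ψ ws)) (ℕ-interchange (φ w) (ψ w) (sumL φ ws) (sumL ψ ws))

sumL-zero : ∀ φ ws → (∀ w → φ w ≡ 0) → sumL φ ws ≡ 0
sumL-zero φ [] φ≡0 = refl
sumL-zero φ (w ∷ ws) φ≡0 = cong₂ _+_ (φ≡0 w) (sumL-zero φ ws φ≡0)

Σ-letter : (Letter → ℕ) → ℕ
Σ-letter f = f U + f H + f D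

Σ-letter-cong : ∀ {f g} → (∀ x → f x ≡ g x) → Σ-letter f ≡ Σ-letter g
Σ-letter-cong eq = cong₂ _+_ (cong₂ _+_ (eq U) (eq H)) (eq D)

Σ-letter-comm : ∀ (F : Letter → Letter → ℕ) →
                Σ-letter (λ y → Σ-letter (F y)) ≡ Σ-letter (λ x → Σ-letter (λ y → F y x))
Σ-letter-comm F = ℕSolver.solve 9
  (λ a b c d e f g h i → a :+ b :+ c :+ (d :+ e :+ f) :+ (g :+ h :+ i)
                      := a :+ d :+ g :+ (b :+ e :+ h) :+ (c :+ f :+ i))
  refl (F U U) (F U H) (F U D) (F H U) (F H H) (F H D) (F D U) (F D H) (F D D)
  where open ℕSolver using (_:+_; _:=_)

sumL-Σ-letter : ∀ (F : Letter → Word → ℕ) ws →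
                sumL (λ w → Σ-letter (λ x → F x w)) ws ≡ Σ-letter (λ x → sumL (F x) ws)
sumL-Σ-letter F ws = trans (sumL-+ _ _ ws) (cong (_+ sumL (F D) ws) (sumL-+ _ _ ws))

sumL-extensions : ∀ φ ws → sumL φ (concatMap (λ w → (U ∷ w) ∷ (H ∷ w) ∷ (D ∷ w) ∷ []) ws)
                          ≡ sumL (λ w → Σ-letter (λ x → φ (x ∷ w))) ws
sumL-extensions φ [] = refl
sumL-extensions φ (w ∷ ws) = begin
  a + (b + (c + sumL φ (concatMap _ ws)))
    ≡⟨ sym (trans (ℕP.+-assoc (a + b) c _) (ℕP.+-assoc a b _)) ⟩
  a + b + c + sumL φ (concatMap _ ws)
    ≡⟨ cong (_+_ (a + b + c)) (sumL-extensions φ ws) ⟩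
  a + b + c + sumL (λ v → Σ-letter (λ x → φ (x ∷ v))) ws ∎
  where
  open ≡-Reasoning
  a = φ (U ∷ w)
  b = φ (H ∷ w)
  c = φ (D ∷ w)

sumL-allWords-∷ : ∀ φ n →
                  sumL φ (allWords (suc n)) ≡ Σ-letter (λ x → sumL (λ w → φ (x ∷ w)) (allWords n))
sumL-allWords-∷ φ n =
  trans (sumL-extensions φ (allWords n)) (sumL-Σ-letter (λ x w → φ (x ∷ w)) (allWords n))

sumL-allWords-∷ʳ : ∀ φ n →
                   sumL φ (allWords (suc n)) ≡ Σ-letter (λ x → sumL (λ w → φ (w ∷ʳ x)) (allWords n))
sumL-allWords-∷ʳ φ zero = sumL-allWords-∷ φ 0
sumL-allWords-∷ʳ φ (suc n) = begin
  sumL φ (allWords (suc (suc n)))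
    ≡⟨ sumL-allWords-∷ φ (suc n) ⟩
  Σ-letter (λ y → sumL (λ w → φ (y ∷ w)) (allWords (suc n)))
    ≡⟨ Σ-letter-cong (λ y → sumL-allWords-∷ʳ (λ w → φ (y ∷ w)) n) ⟩
  Σ-letter (λ y → Σ-letter (λ x → sumL (λ w → φ (y ∷ (w ∷ʳ x))) (allWords n)))
    ≡⟨ Σ-letter-comm (λ y x → sumL (λ w → φ (y ∷ (w ∷ʳ x))) (allWords n)) ⟩
  Σ-letter (λ x → Σ-letter (λ y → sumL (λ w → φ (y ∷ (w ∷ʳ x))) (allWords n)))
    ≡⟨ Σ-letter-cong (λ x → sym (sumL-allWords-∷ (λ w → φ (w ∷ʳ x)) n)) ⟩
  Σ-letter (λ x → sumL (λ w → φ (w ∷ʳ x)) (allWords (suc n))) ∎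
  where open ≡-Reasoning

run-∷ʳ : ∀ s w x → run s (w ∷ʳ x) ≡ step (run s w) x
run-∷ʳ s [] x = refl
run-∷ʳ s (y ∷ w) x = run-∷ʳ (step s y) w x

Σ-last : (Maybe Letter → ℕ) → ℕ
Σ-last f = f nothing + f (just U) + f (just H) + f (just D)

sumL-Σ-last : ∀ (F : Maybe Letter → Word → ℕ) ws →
              sumL (λ w → Σ-last (λ q → F q w)) ws ≡ Σ-last (λ q → sumL (F q) ws)
sumL-Σ-last F ws = trans (sumL-+ _ _ ws)
  (cong (_+ sumL (F (just D)) ws) (trans (sumL-+ _ _ ws) (cong (_+ sumL (F (just H)) ws) (sumL-+ _ _ ws))))

hits : ℕ → Maybe Letter → State → ℕ
hits j q dead = 0
hits j q (at h p) = indicator (does (≡-dec _≟L_ p q) ∧ (h ≡ᵇ j))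

Σ-last-hits : ∀ j s → Σ-last (λ q → hits j q s) ≡ indicator (accepts j s)
Σ-last-hits j dead = refl
Σ-last-hits j (at h p) with h ≡ᵇ j
Σ-last-hits j (at h nothing) | true = refl
Σ-last-hits j (at h (just U)) | true = refl
Σ-last-hits j (at h (just H)) | true = refl
Σ-last-hits j (at h (just D)) | true = refl
Σ-last-hits j (at h nothing) | false = refl
Σ-last-hits j (at h (just U)) | false = refl
Σ-last-hits j (at h (just H)) | false = refl
Σ-last-hits j (at h (just D)) | false = refl

hits-step-nothing : ∀ j s → Σ-letter (λ x → hits j nothing (step s x)) ≡ 0
hits-step-nothing j dead = refl
hits-step-nothing j (at zero nothing) = refl
hits-step-nothing j (at zero (just U)) = refl
hits-step-nothing j (at zero (just H)) = refl
hits-step-nothing j (at zero (just D)) = refl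
hits-step-nothing j (at (suc h) nothing) = refl
hits-step-nothing j (at (suc h) (just U)) = refl
hits-step-nothing j (at (suc h) (just H)) = refl
hits-step-nothing j (at (suc h) (just D)) = refl

hits-step-U-zero : ∀ s → Σ-letter (λ x → hits 0 (just U) (step s x)) ≡ 0
hits-step-U-zero dead = refl
hits-step-U-zero (at zero nothing) = refl
hits-step-U-zero (at zero (just U)) = refl
hits-step-U-zero (at zero (just H)) = refl
hits-step-U-zero (at zero (just D)) = refl
hits-step-U-zero (at (suc h) nothing) = refl
hits-step-U-zero (at (suc h) (just U)) = refl
hits-step-U-zero (at (suc h) (just H)) = refl
hits-step-U-zero (at (suc h) (just D)) = refl

hits-step-U : ∀ j s → Σ-letter (λ x → hits (suc j) (just U) (step s x)) ≡ indicator (accepts j s)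
hits-step-U j dead = refl
hits-step-U j (at zero nothing) with zero ≡ᵇ j
... | true = refl
... | false = refl
hits-step-U j (at zero (just U)) with zero ≡ᵇ j
... | true = refl
... | false = refl
hits-step-U j (at zero (just H)) with zero ≡ᵇ j
... | true = refl
... | false = refl
hits-step-U j (at zero (just D)) with zero ≡ᵇ j
... | true = refl
... | false = refl
hits-step-U j (at (suc h) nothing) with suc h ≡ᵇ j
... | true = refl
... | false = refl
hits-step-U j (at (suc h) (just U)) with suc h ≡ᵇ j
... | true = refl
... | false = refl
hits-step-U j (at (suc h) (just H)) with suc h ≡ᵇ j
... | true = refl
... | false = refl
hits-step-U j (at (suc h) (just D)) with suc h ≡ᵇ j
... | true = refl
... | false = refl

hits-step-H : ∀ j s →
              Σ-letter (λ x → hits j (just H) (step s x)) + hits j (just H) s ≡ indicator (accepts j s)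
hits-step-H j dead = refl
hits-step-H j (at zero nothing) with zero ≡ᵇ j
... | true = refl
... | false = refl
hits-step-H j (at zero (just U)) with zero ≡ᵇ j
... | true = refl
... | false = refl
hits-step-H j (at zero (just H)) with zero ≡ᵇ j
... | true = refl
... | false = refl
hits-step-H j (at zero (just D)) with zero ≡ᵇ j
... | true = refl
... | false = refl
hits-step-H j (at (suc h) nothing) with suc h ≡ᵇ j
... | true = refl
... | false = refl
hits-step-H j (at (suc h) (just U)) with suc h ≡ᵇ j
... | true = refl
... | false = refl
hits-step-H j (at (suc h) (just H)) with suc h ≡ᵇ j
... | true = refl
... | false = refl
hits-step-H j (at (suc h) (just D)) with suc h ≡ᵇ j
... | true = refl
... | false = refl

hits-step-D : ∀ j s → Σ-letter (λ x → hits j (just D) (step s x)) + hits (suc j) (just U) s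
                      ≡ indicator (accepts (suc j) s)
hits-step-D j dead = refl
hits-step-D j (at zero nothing) = refl
hits-step-D j (at zero (just U)) = refl
hits-step-D j (at zero (just H)) = refl
hits-step-D j (at zero (just D)) = refl
hits-step-D j (at (suc h) nothing) with h ≡ᵇ j
... | true = refl
... | false = refl
hits-step-D j (at (suc h) (just U)) with h ≡ᵇ j
... | true = refl
... | false = refl
hits-step-D j (at (suc h) (just H)) with h ≡ᵇ j
... | true = refl
... | false = refl
hits-step-D j (at (suc h) (just D)) with h ≡ᵇ j
... | true = refl
... | false = refl

countLast : ℕ → ℕ → Maybe Letter → ℕ
countLast n j q = sumL (λ w → hits j q (run start w)) (allWords n)

count≡sumL-accepts : ∀ n j → count n j ≡ sumL (λ w → indicator (accepts j (run start w))) (allWords n)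
count≡sumL-accepts n j = trans (length-filter (mAt? j) (allWords n))
  (sumL-cong (allWords n) (λ w → cong indicator (mAt?≡accepts j w)))

count≡Σ-last-countLast : ∀ n j → count n j ≡ Σ-last (countLast n j)
count≡Σ-last-countLast n j = begin
  count n j
    ≡⟨ count≡sumL-accepts n j ⟩
  sumL (λ w → indicator (accepts j (run start w))) (allWords n)
    ≡⟨ sumL-cong (allWords n) (λ w → sym (Σ-last-hits j (run start w))) ⟩
  sumL (λ w → Σ-last (λ q → hits j q (run start w))) (allWords n)
    ≡⟨ sumL-Σ-last (λ q w → hits j q (run start w)) (allWords n) ⟩
  Σ-last (countLast n j) ∎
  where open ≡-Reasoning

countLast-suc : ∀ n j q →
  countLast (suc n) j q ≡ sumL (λ w → Σ-letter (λ x → hits j q (step (run start w) x))) (allWords n)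
countLast-suc n j q = begin
  countLast (suc n) j q
    ≡⟨ sumL-allWords-∷ʳ (λ w → hits j q (run start w)) n ⟩
  Σ-letter (λ x → sumL (λ w → hits j q (run start (w ∷ʳ x))) (allWords n))
    ≡⟨ Σ-letter-cong (λ x → sumL-cong (allWords n) (λ w → cong (hits j q) (run-∷ʳ start w x))) ⟩
  Σ-letter (λ x → sumL (λ w → hits j q (step (run start w) x)) (allWords n))
    ≡⟨ sym (sumL-Σ-letter (λ x w → hits j q (step (run start w) x)) (allWords n)) ⟩
  sumL (λ w → Σ-letter (λ x → hits j q (step (run start w) x))) (allWords n) ∎
  where open ≡-Reasoning

countLast-nothing : ∀ n j → countLast (suc n) j nothing ≡ 0
countLast-nothing n j = trans (countLast-suc n j nothing)
  (sumL-zero _ (allWords n) (λ w → hits-step-nothing j (run start w)))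

countLast-U-zero : ∀ n → countLast (suc n) 0 (just U) ≡ 0
countLast-U-zero n = trans (countLast-suc n 0 (just U))
  (sumL-zero _ (allWords n) (λ w → hits-step-U-zero (run start w)))

countLast-U : ∀ n j → countLast (suc n) (suc j) (just U) ≡ count n j
countLast-U n j = begin
  countLast (suc n) (suc j) (just U) ≡⟨ countLast-suc n (suc j) (just U) ⟩
  _                                  ≡⟨ sumL-cong (allWords n) (λ w → hits-step-U j (run start w)) ⟩
  _                                  ≡⟨ sym (count≡sumL-accepts n j) ⟩
  count n j                          ∎
  where open ≡-Reasoning

countLast-H : ∀ n j → countLast (suc n) j (just H) + countLast n j (just H) ≡ count n j
countLast-H n j = begin
  countLast (suc n) j (just H) + countLast n j (just H)
    ≡⟨ cong (_+ countLast n j (just H)) (countLast-suc n j (just H)) ⟩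
  _ ≡⟨ sym (sumL-+ _ _ (allWords n)) ⟩
  _ ≡⟨ sumL-cong (allWords n) (λ w → hits-step-H j (run start w)) ⟩
  _ ≡⟨ sym (count≡sumL-accepts n j) ⟩
  count n j ∎
  where open ≡-Reasoning

countLast-D : ∀ n j → countLast (suc n) j (just D) + countLast n (suc j) (just U) ≡ count n (suc j)
countLast-D n j = begin
  countLast (suc n) j (just D) + countLast n (suc j) (just U)
    ≡⟨ cong (_+ countLast n (suc j) (just U)) (countLast-suc n j (just D)) ⟩
  _ ≡⟨ sym (sumL-+ _ _ (allWords n)) ⟩
  _ ≡⟨ sumL-cong (allWords n) (λ w → hits-step-D j (run start w)) ⟩
  _ ≡⟨ sym (count≡sumL-accepts n (suc j)) ⟩
  count n (suc j) ∎
  where open ≡-Reasoning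

coeffU-⊛₂-suc : ∀ F G → (∀ b → coeffU (suc (suc b)) F ≈ 0S) →
                ∀ j → coeffU (suc j) (F ⊛₂ G)
                      ≈ ((coeffU 0 F ⊛ coeffU (suc j) G) ⊕ (coeffU 1 F ⊛ coeffU j G))
coeffU-⊛₂-suc F G F-linear j n = trans (sumTo-cong n degree≤1) (sumTo-+ n _ _)
  where
  degree≤1 : ∀ a → sumTo (suc j) (λ b → F a b *q G (n ∸ a) (suc j ∸ b))
                 ≡ F a 0 *q G (n ∸ a) (suc j) +q F a 1 *q G (n ∸ a) j
  degree≤1 a = trans (sumTo-unfoldˡ j _) (cong (F a 0 *q G (n ∸ a) (suc j) +q_)
    (sumTo-head j _ λ b → trans (cong (_*q G (n ∸ a) (j ∸ suc b)) (F-linear b a))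
                                (ℚP.*-zeroˡ (G (n ∸ a) (j ∸ suc b)))))

coeffU-lift-⊛₂ : ∀ f G j → coeffU j (lift f ⊛₂ G) ≈ (f ⊛ coeffU j G)
coeffU-lift-⊛₂ f G j n = sumTo-cong n λ a → sumTo-head j _ λ b → ℚP.*-zeroˡ (G (n ∸ a) (j ∸ suc b))

coeffU-uB-⊛₂-zero : ∀ G → coeffU 0 (uB ⊛₂ G) ≈ 0S
coeffU-uB-⊛₂-zero G n = trans (sumTo-head n _ λ a → ℚP.*-zeroˡ (G (n ∸ suc a) 0)) (ℚP.*-zeroˡ (G n 0))

coeffU-uB-⊛₂-suc : ∀ G j → coeffU (suc j) (uB ⊛₂ G) ≈ coeffU j G
coeffU-uB-⊛₂-suc G j n = begin
  (uB ⊛₂ G) n (suc j)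
    ≡⟨ sumTo-head n _ (λ a → sumTo-zero (suc j) _ λ b → ℚP.*-zeroˡ (G (n ∸ suc a) (suc j ∸ b))) ⟩
  sumTo (suc j) (λ b → uB 0 b *q G n (suc j ∸ b))
    ≡⟨ sumTo-unfoldˡ j _ ⟩
  0ℚ *q G n (suc j) +q sumTo j (λ b → uB 0 (suc b) *q G n (j ∸ b))
    ≡⟨ cong₂ _+q_ (ℚP.*-zeroˡ (G n (suc j))) (sumTo-head j _ λ b → ℚP.*-zeroˡ (G n (j ∸ suc b))) ⟩
  0ℚ +q 1ℚ *q G n j
    ≡⟨ trans (ℚP.+-identityˡ _) (ℚP.*-identityˡ (G n j)) ⟩
  G n j ∎
  where open ≡-Reasoning

toℚ : ℕ → ℚ
toℚ n = + n ℚ./ 1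

toℚ-+ : ∀ a b → toℚ (a + b) ≡ toℚ a +q toℚ b
toℚ-+ a b = sym (trans (cong₂ _+q_ (toℚ≡mkℚ a) (toℚ≡mkℚ b))
  (cong (ℚ._/ 1) (cong₂ ℤ._+_ (ℤP.*-identityʳ (+ a)) (ℤP.*-identityʳ (+ b)))))
  where
  toℚ≡mkℚ : ∀ n → toℚ n ≡ ℚ.mkℚ (+ n) 0 (Coprime.sym (Coprime.1-coprimeTo n))
  toℚ≡mkℚ n = ℚP.normalize-coprime (Coprime.sym (Coprime.1-coprimeTo n))

Σ-lastℚ : (Maybe Letter → ℚ) → ℚ
Σ-lastℚ f = f nothing +q f (just U) +q f (just H) +q f (just D)

toℚ-Σ-last : ∀ f → toℚ (Σ-last f) ≡ Σ-lastℚ (toℚ ∘ f)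
toℚ-Σ-last f = begin
  toℚ (f nothing + f (just U) + f (just H) + f (just D))
    ≡⟨ toℚ-+ (f nothing + f (just U) + f (just H)) (f (just D)) ⟩
  toℚ (f nothing + f (just U) + f (just H)) +q toℚ (f (just D))
    ≡⟨ cong (_+q toℚ (f (just D))) (toℚ-+ (f nothing + f (just U)) (f (just H))) ⟩
  toℚ (f nothing + f (just U)) +q toℚ (f (just H)) +q toℚ (f (just D))
    ≡⟨ cong (λ x → x +q toℚ (f (just H)) +q toℚ (f (just D))) (toℚ-+ (f nothing) (f (just U))) ⟩
  Σ-lastℚ (toℚ ∘ f) ∎
  where open ≡-Reasoning

Σ-lastℚ-cong : ∀ {f g} → (∀ q → f q ≡ g q) → Σ-lastℚ f ≡ Σ-lastℚ g
Σ-lastℚ-cong eq = cong₂ _+q_ (cong₂ _+q_ (cong₂ _+q_ (eq nothing) (eq (just U))) (eq (just H))) (eq (just D))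

toℚ-split : ∀ a b {c} → a + b ≡ c → toℚ a ≡ toℚ c -q toℚ b
toℚ-split a b a+b≡c = x≈z//y (toℚ a) (toℚ b) _ (trans (sym (toℚ-+ a b)) (cong toℚ a+b≡c))

numerator denominator radicand₁ radicand₂ : List ℤ
numerator = + 1 ∷ + 0 ∷ + 1 ∷ + 1 ∷ []
denominator = + 0 ∷ + 2 ∷ + 2 ∷ []
radicand₁ = + 1 ∷ + 2 ∷ + 3 ∷ + 1 ∷ []
radicand₂ = + 1 ∷ -[1+ 1 ] ∷ -[1+ 0 ] ∷ + 1 ∷ []

hornerE : ∀ {m} → List ℤ → FPS-Solver.Polynomial m → FPS-Solver.Polynomial m
hornerE [] x = FPS-Solver.con 0ℚ
hornerE (c ∷ cs) x = FPS-Solver.con (c ℚ./ 1) FPS-Solver.:+ x FPS-Solver.:* hornerE cs x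

module _ (W r : FPS) (W²≈radicand : (W ⊛ W) ≈ radicand) (isR1 : IsR1 W r) where

  private
    P K R₁ R₂ : FPS
    P = horner numerator
    K = horner denominator
    R₁ = horner radicand₁
    R₂ = horner radicand₂

    W≈P-Kr : W ≈ (P ⊕ (⊖ (K ⊛ r)))
    W≈P-Kr = begin
      W                         ≈⟨ solve 2 (λ p w → w := p :- (p :- w)) (λ _ → refl) P W ⟩
      P ⊕ (⊖ (P ⊕ (⊖ W)))           ≈⟨ ⊕-congʳ P (λ n → cong ℚ.-_ (sym (Kr≈P-W n))) ⟩
      P ⊕ (⊖ (K ⊛ r))             ∎
      where
      open SetoidReasoning FPS-setoid
      open FPS-Solver using (solve; _:-_; _:=_)
      Kr≈P-W : (K ⊛ r) ≈ (P ⊕ (⊖ W))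
      Kr≈P-W n = trans (⊛-congˡ r (λ k → sym (poly≈horner denominator k)) n)
                   (trans (isR1 n) (cong (_-q W n) (poly≈horner numerator n)))

    [P-Kr]²≈R₁R₂ : ((P ⊕ (⊖ (K ⊛ r))) ⊛ (P ⊕ (⊖ (K ⊛ r)))) ≈ (R₁ ⊛ R₂)
    [P-Kr]²≈R₁R₂ n = trans (sym (⊛-cong W≈P-Kr W≈P-Kr n))
      (trans (W²≈radicand n) (⊛-cong (poly≈horner radicand₁) (poly≈horner radicand₂) n))

  -- (P − K r)² − R₁ R₂ = 4 z(1+z) (z(1+z)(1 + r²) − P r), because P² − R₁ R₂ = 4 z²(1+z)².
  r1-quadratic : (zS ⊛ (1+z ⊛ (const 1ℚ ⊕ (r ⊛ r)))) ≈ (P ⊛ r)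
  r1-quadratic = 1+z⊛-cancel (z⊛-cancel (begin
    zS ⊛ (1+z ⊛ (zS ⊛ (1+z ⊛ (const 1ℚ ⊕ (r ⊛ r)))))
      ≈⟨ solve 2 (λ z r → z :* (1+zE z :* (z :* (1+zE z :* (con 1ℚ :+ r :* r))))
                       := z :* (1+zE z :* (hornerE numerator z :* r))
                          :+ con ¼ :* ([P-Kr]E z r :* [P-Kr]E z r :- R₁R₂E z))
           (λ _ → refl) zS r ⟩
    (zS ⊛ (1+z ⊛ (P ⊛ r))) ⊕ (const ¼ ⊛ (([P-Kr] ⊛ [P-Kr]) ⊕ (⊖ (R₁ ⊛ R₂))))
      ≈⟨ ⊕-congʳ (zS ⊛ (1+z ⊛ (P ⊛ r)))
           (⊛-congʳ (const ¼) (⊕-congˡ (⊖ (R₁ ⊛ R₂)) [P-Kr]²≈R₁R₂)) ⟩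
    (zS ⊛ (1+z ⊛ (P ⊛ r))) ⊕ (const ¼ ⊛ ((R₁ ⊛ R₂) ⊕ (⊖ (R₁ ⊛ R₂))))
      ≈⟨ solve 2 (λ z r → z :* (1+zE z :* (hornerE numerator z :* r))
                          :+ con ¼ :* (R₁R₂E z :- R₁R₂E z)
                       := z :* (1+zE z :* (hornerE numerator z :* r)))
           (λ _ → refl) zS r ⟩
    zS ⊛ (1+z ⊛ (P ⊛ r)) ∎))
    where
    open SetoidReasoning FPS-setoid
    open FPS-Solver using (solve; con; _:+_; _:-_; _:*_; _:=_)
    ¼ : ℚ
    ¼ = + 1 ℚ./ 4
    [P-Kr] : FPS
    [P-Kr] = P ⊕ (⊖ (K ⊛ r))
    1+zE : ∀ {m} → FPS-Solver.Polynomial m → FPS-Solver.Polynomial m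
    1+zE z = con 1ℚ :+ z
    [P-Kr]E : ∀ {m} → FPS-Solver.Polynomial m → FPS-Solver.Polynomial m → FPS-Solver.Polynomial m
    [P-Kr]E z r = hornerE numerator z :- hornerE denominator z :* r
    R₁R₂E : ∀ {m} → FPS-Solver.Polynomial m → FPS-Solver.Polynomial m
    R₁R₂E z = hornerE radicand₁ z :* hornerE radicand₂ z

  r1-zero : r 0 ≡ 0ℚ
  r1-zero = trans (sym (ℚP.*-identityˡ (r 0)))
    (trans (sym (r1-quadratic 0)) (z⊛-zero (1+z ⊛ (const 1ℚ ⊕ (r ⊛ r)))))

  r1⊛-zero : ∀ p → (r ⊛ p) 0 ≡ 0ℚ
  r1⊛-zero p = trans (cong (_*q p 0) r1-zero) (ℚP.*-zeroˡ (p 0))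

  shift-r1⊛ : ∀ p →
    shift (r ⊛ p) ≈ (((p ⊕ ÷1+z (r ⊛ p)) ⊕ (r ⊛ (r ⊛ p))) ⊕ (⊖ (zS ⊛ (r ⊛ p))))
  shift-r1⊛ p = z⊛-cancel (λ n → trans (z⊛-shift (r ⊛ p) (r1⊛-zero p) n) (sym (z⊛Y≈rp n)))
    where
    G = ÷1+z (r ⊛ p)
    Y = ((p ⊕ G) ⊕ (r ⊛ (r ⊛ p))) ⊕ (⊖ (zS ⊛ (r ⊛ p)))
    z⊛Y≈rp : (zS ⊛ Y) ≈ (r ⊛ p)
    z⊛Y≈rp = 1+z⊛-cancel (begin
      1+z ⊛ (zS ⊛ Y)
        ≈⟨ solve 4 (λ z r p g → (con 1ℚ :+ z) :* (z :* (((p :+ g) :+ r :* (r :* p)) :- z :* (r :* p)))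
                             := (z :* ((con 1ℚ :+ z) :* (con 1ℚ :+ r :* r)) :* p
                                   :+ z :* ((con 1ℚ :+ z) :* g))
                                :- ((con 1ℚ :+ z) :* (z :* z)) :* (r :* p))
             (λ _ → refl) zS r p G ⟩
      (((zS ⊛ (1+z ⊛ (const 1ℚ ⊕ (r ⊛ r)))) ⊛ p) ⊕ (zS ⊛ (1+z ⊛ G)))
        ⊕ (⊖ ((1+z ⊛ (zS ⊛ zS)) ⊛ (r ⊛ p)))
        ≈⟨ ⊕-congˡ (⊖ ((1+z ⊛ (zS ⊛ zS)) ⊛ (r ⊛ p)))
             (λ n → cong₂ _+q_ (⊛-congˡ p r1-quadratic n) (⊛-congʳ zS (1+z⊛÷1+z (r ⊛ p)) n)) ⟩
      (((P ⊛ r) ⊛ p) ⊕ (zS ⊛ (r ⊛ p))) ⊕ (⊖ ((1+z ⊛ (zS ⊛ zS)) ⊛ (r ⊛ p)))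
        ≈⟨ solve 3 (λ z r p → ((hornerE numerator z :* r) :* p :+ z :* (r :* p))
                                :- ((con 1ℚ :+ z) :* (z :* z)) :* (r :* p)
                             := (con 1ℚ :+ z) :* (r :* p))
             (λ _ → refl) zS r p ⟩
      1+z ⊛ (r ⊛ p) ∎)
      where
      open SetoidReasoning FPS-setoid
      open FPS-Solver using (solve; con; _:+_; _:-_; _:*_; _:=_)

  closedForm : ℕ → ℕ → Maybe Letter → ℚ
  closedForm n j (just H) = ÷1+z (r ^^ suc j) n
  closedForm n j (just D) = (r ^^ suc (suc j)) n -q (zS ⊛ (r ^^ suc j)) n
  closedForm n zero nothing = one n
  closedForm n (suc j) nothing = 0ℚ
  closedForm n zero (just U) = 0ℚ
  closedForm n (suc j) (just U) = (r ^^ suc j) n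

  closedForm-total : ∀ n j → Σ-lastℚ (closedForm n j) ≡ (r ^^ suc j) (suc n)
  closedForm-total n j = begin
    Σ-lastℚ (closedForm n j)
      ≡⟨ cong (λ x → x +q closedForm n j (just H) +q closedForm n j (just D)) (nothing+U≡r^^j j) ⟩
    (r ^^ j) n +q ÷1+z (r ^^ suc j) n +q ((r ^^ suc (suc j)) n -q (zS ⊛ (r ^^ suc j)) n)
      ≡⟨ ℚSolver.solve 4 (λ a b c d → a :+ b :+ (c :- d) := a :+ b :+ c :- d) refl
           ((r ^^ j) n) (÷1+z (r ^^ suc j) n) ((r ^^ suc (suc j)) n) ((zS ⊛ (r ^^ suc j)) n) ⟩
    (r ^^ j) n +q ÷1+z (r ^^ suc j) n +q (r ^^ suc (suc j)) n -q (zS ⊛ (r ^^ suc j)) n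
      ≡⟨ sym (shift-r1⊛ (r ^^ j) n) ⟩
    (r ^^ suc j) (suc n) ∎
    where
    open ≡-Reasoning
    open ℚSolver using (_:+_; _:-_; _:=_)
    nothing+U≡r^^j : ∀ j → closedForm n j nothing +q closedForm n j (just U) ≡ (r ^^ j) n
    nothing+U≡r^^j zero = ℚP.+-identityʳ (one n)
    nothing+U≡r^^j (suc j) = ℚP.+-identityˡ ((r ^^ suc j) n)

  countLast⇒count-closedForm : ∀ n j → (∀ q → toℚ (countLast n j q) ≡ closedForm n j q) →
                               toℚ (count n j) ≡ (r ^^ suc j) (suc n)
  countLast⇒count-closedForm n j countLast≡ = begin
    toℚ (count n j)                ≡⟨ cong toℚ (count≡Σ-last-countLast n j) ⟩
    toℚ (Σ-last (countLast n j))   ≡⟨ toℚ-Σ-last (countLast n j) ⟩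
    Σ-lastℚ (toℚ ∘ countLast n j)  ≡⟨ Σ-lastℚ-cong countLast≡ ⟩
    Σ-lastℚ (closedForm n j)       ≡⟨ closedForm-total n j ⟩
    (r ^^ suc j) (suc n)           ∎
    where open ≡-Reasoning

  count-closedForm : ∀ n j → toℚ (count n j) ≡ (r ^^ suc j) (suc n)

  countLast-closedForm : ∀ n j q → toℚ (countLast n j q) ≡ closedForm n j q
  countLast-closedForm zero zero nothing = refl
  countLast-closedForm zero (suc j) nothing = refl
  countLast-closedForm zero zero (just U) = refl
  countLast-closedForm zero (suc j) (just U) = sym (r1⊛-zero (r ^^ j))
  countLast-closedForm zero j (just H) = sym (r1⊛-zero (r ^^ j))
  countLast-closedForm zero j (just D) = sym (cong₂ _-q_ (r1⊛-zero (r ^^ suc j)) (z⊛-zero (r ^^ suc j)))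
  countLast-closedForm (suc n) zero nothing = cong toℚ (countLast-nothing n zero)
  countLast-closedForm (suc n) (suc j) nothing = cong toℚ (countLast-nothing n (suc j))
  countLast-closedForm (suc n) zero (just U) = cong toℚ (countLast-U-zero n)
  countLast-closedForm (suc n) (suc j) (just U) = trans (cong toℚ (countLast-U n j)) (count-closedForm n j)
  countLast-closedForm (suc n) j (just H) = trans (toℚ-split _ (countLast n j (just H)) (countLast-H n j))
    (cong₂ _-q_ (count-closedForm n j) (countLast-closedForm n j (just H)))
  countLast-closedForm (suc n) j (just D) = trans (toℚ-split _ (countLast n (suc j) (just U)) (countLast-D n j))
    (cong₂ _-q_ (count-closedForm n (suc j))
                (trans (countLast-closedForm n (suc j) (just U)) (sym (z⊛-suc (r ^^ suc j) n))))

  count-closedForm n j = countLast⇒count-closedForm n j (countLast-closedForm n j)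

  1-u·r : BPS
  1-u·r = lift one ⊕₂ (⊖₂ (uB ⊛₂ lift r))

  coeffU-1-u·r-zero : coeffU 0 1-u·r ≈ const 1ℚ
  coeffU-1-u·r-zero m = trans (cong (λ x → one m +q ℚ.- x) (coeffU-uB-⊛₂-zero (lift r) m)) (one-0 m)
    where
    one-0 : ∀ m → one m +q ℚ.- 0ℚ ≡ const 1ℚ m
    one-0 zero = refl
    one-0 (suc m) = refl

  coeffU-1-u·r-one : coeffU 1 1-u·r ≈ (⊖ r)
  coeffU-1-u·r-one m =
    trans (cong (λ x → 0ℚ +q ℚ.- x) (coeffU-uB-⊛₂-suc (lift r) 0 m)) (ℚP.+-identityˡ (ℚ.- r m))

  coeffU-1-u·r-high : ∀ b → coeffU (suc (suc b)) 1-u·r ≈ 0S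
  coeffU-1-u·r-high b m = cong (λ x → 0ℚ +q ℚ.- x) (coeffU-uB-⊛₂-suc (lift r) (suc b) m)

  coeffU-S : ∀ j → (zS ⊛ coeffU j S) ≈ (r ^^ suc j)
  coeffU-S j zero = trans (z⊛-zero (coeffU j S)) (sym (r1⊛-zero (r ^^ j)))
  coeffU-S j (suc n) = trans (z⊛-suc (coeffU j S) n) (count-closedForm n j)

  coeffU-z⊛₂1-u·r : ∀ b {g} → coeffU b 1-u·r ≈ g → coeffU b (lift zS ⊛₂ 1-u·r) ≈ (zS ⊛ g)
  coeffU-z⊛₂1-u·r b coeff≈g m = trans (coeffU-lift-⊛₂ zS 1-u·r b m) (⊛-congʳ zS coeff≈g m)

  S-functionalEquation : ((lift zS ⊛₂ 1-u·r) ⊛₂ S) ≈₂ lift r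
  S-functionalEquation n zero = begin
    ((lift zS ⊛₂ 1-u·r) ⊛₂ S) n 0
      ≡⟨ ⊛-congˡ (coeffU 0 S) (coeffU-z⊛₂1-u·r 0 coeffU-1-u·r-zero) n ⟩
    ((zS ⊛ const 1ℚ) ⊛ coeffU 0 S) n
      ≡⟨ solve 2 (λ z s → z :* con 1ℚ :* s := z :* s) (λ _ → refl) zS (coeffU 0 S) n ⟩
    (zS ⊛ coeffU 0 S) n
      ≡⟨ coeffU-S 0 n ⟩
    (r ⊛ one) n
      ≡⟨ trans (⊛-comm r one n) (⊛-identityˡ r n) ⟩
    r n ∎
    where
    open ≡-Reasoning
    open FPS-Solver using (solve; con; _:*_; _:=_)
  S-functionalEquation n (suc j) = begin
    ((lift zS ⊛₂ 1-u·r) ⊛₂ S) n (suc j)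
      ≡⟨ coeffU-⊛₂-suc (lift zS ⊛₂ 1-u·r) S high j n ⟩
    ((coeffU 0 (lift zS ⊛₂ 1-u·r) ⊛ coeffU (suc j) S) ⊕ (coeffU 1 (lift zS ⊛₂ 1-u·r) ⊛ coeffU j S)) n
      ≡⟨ cong₂ _+q_ (⊛-congˡ (coeffU (suc j) S) (coeffU-z⊛₂1-u·r 0 coeffU-1-u·r-zero) n)
                    (⊛-congˡ (coeffU j S) (coeffU-z⊛₂1-u·r 1 coeffU-1-u·r-one) n) ⟩
    (((zS ⊛ const 1ℚ) ⊛ coeffU (suc j) S) ⊕ ((zS ⊛ (⊖ r)) ⊛ coeffU j S)) n
      ≡⟨ solve 4 (λ z r s s′ → z :* con 1ℚ :* s′ :+ z :* (:- r) :* s := z :* s′ :- r :* (z :* s))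
           (λ _ → refl) zS r (coeffU j S) (coeffU (suc j) S) n ⟩
    (zS ⊛ coeffU (suc j) S) n +q ℚ.- (r ⊛ (zS ⊛ coeffU j S)) n
      ≡⟨ cong₂ (λ a b → a +q ℚ.- b) (coeffU-S (suc j) n) (⊛-congʳ r (coeffU-S j) n) ⟩
    (r ^^ suc (suc j)) n +q ℚ.- (r ^^ suc (suc j)) n
      ≡⟨ ℚP.+-inverseʳ ((r ^^ suc (suc j)) n) ⟩
    0ℚ ∎
    where
    open ≡-Reasoning
    open FPS-Solver using (solve; con; _:+_; _:-_; _:*_; :-_; _:=_)
    high : ∀ b → coeffU (suc (suc b)) (lift zS ⊛₂ 1-u·r) ≈ 0S
    high b m = trans (coeffU-z⊛₂1-u·r (suc (suc b)) (coeffU-1-u·r-high b) m)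
                     (trans (⊛-comm zS 0S m) (⊛-zeroˡ zS m))

mainTheorem5 : (W r1 : FPS) → IsW W → IsR1 W r1 →
    ((lift zS ⊛₂ (lift one ⊕₂ (⊖₂ (uB ⊛₂ lift r1)))) ⊛₂ S) ≈₂ lift r1
    × (∀ (j : ℕ) → (zS ⊛ coeffU j S) ≈ (r1 ^^ suc j))
mainTheorem5 W r1 (_ , W²≈radicand) isR1 =
  S-functionalEquation W r1 W²≈radicand isR1 , coeffU-S W r1 W²≈radicand isR1
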